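{- Let $\mathcal{F}$ be a nice family of graphs, let $G$ be an $\mathcal{F}$-free graph, and let $G'$ be obtained from $G$ by symmetrizing a vertex $u$ to a vertex $v$ that is not adjacent to $u$. Then $G'$ is $\mathcal{F}$-free.
   Context: A (finite or infinite) sequence of graphs $F_1,F_2,\dots$ is nice if for every $i$ and every pair of non-adjacent vertices $u,v$ of $F_i$, the graph $F_i'$ obtained from $F_i$ by joining both $u$ and $v$ to every vertex of $N(u)\cup N(v)$ contains some $F_j$ with $j<i$ as a subgraph. A family $\mathcal{F}$ of graphs is nice if its elements can be ordered to form a nice sequence. A graph is $\mathcal{F}$-free if it contains no member of $\mathcal{F}$ as a subgraph. Symmetrizing $u$ to $v$ in a graph means deleting all edges incident to $u$ and then adding all edges $uw$ for $w$ a neighbor of $v$ (i.e., replacing the neighborhood of $u$ by that of $v$). -}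

module Defs where

open import Data.Nat using (ℕ; _<_)
open import Data.Fin using (Fin; toℕ; _≟_)
open import Data.Bool using (Bool; true; false; _∧_; _∨_; not; if_then_else_)
open import Data.Maybe using (Maybe; just; nothing)
open import Data.Product using (Σ; _×_)
open import Data.Sum using (_⊎_)
open import Relation.Nullary using (¬_)
open import Relation.Nullary.Decidable using (⌊_⌋)
open import Relation.Binary.PropositionalEquality using (_≡_; _≢_)
open import Function using (_∘_)
open import Function.Definitions using (Injective)
open import Function.Bundles using (_⤖_; Bijection)

-- Edges are symmetrised and loops are ignored: x ~ y iff x ≢ y and
-- (adj x y or adj y x).  Every matrix thus denotes a simple graph.
record Graph : Set where
  constructor mkGraph
  field
    n   : ℕ
    adj : Fin n → Fin n → Bool
open Graph public

V : Graph → Set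
V G = Fin (n G)

Edge : (G : Graph) → V G → V G → Set
Edge G x y = x ≢ y × (adj G x y ≡ true ⊎ adj G y x ≡ true)

edgeB : (G : Graph) → V G → V G → Bool
edgeB G x y = not ⌊ x ≟ y ⌋ ∧ (adj G x y ∨ adj G y x)

Contains : Graph → Graph → Set
Contains G H = Σ (V H → V G) λ f → Injective _≡_ _≡_ f × (∀ i j → Edge H i j → Edge G (f i) (f j))

Free : {I : Set} → (I → Graph) → Graph → Set
Free {I} F G = ∀ (i : I) → ¬ Contains G (F i)

-- F' : join both u and v to every vertex of N(u) ∪ N(v)
join : (G : Graph) → V G → V G → Graph
join G u v = mkGraph (n G) λ x y →
  adj G x y ∨ ((⌊ x ≟ u ⌋ ∨ ⌊ x ≟ v ⌋) ∧ (edgeB G u y ∨ edgeB G v y))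

-- symmetrize u to v: replace N(u) by N(v)
symmetrize : (G : Graph) → V G → V G → Graph
symmetrize G u v = mkGraph (n G) λ x y →
  if ⌊ x ≟ u ⌋ then edgeB G v y
  else if ⌊ y ≟ u ⌋ then edgeB G v x
  else adj G x y

-- Index sets of finite (just k) or infinite (nothing) sequences
Idx : Maybe ℕ → Set
Idx (just k) = Fin k
Idx nothing  = ℕ

pos : (m : Maybe ℕ) → Idx m → ℕ
pos (just k) i = toℕ i
pos nothing  i = i

NiceSeq : (m : Maybe ℕ) → (Idx m → Graph) → Set
NiceSeq m S = ∀ (i : Idx m) (u v : V (S i)) → u ≢ v → ¬ Edge (S i) u v →
  Σ (Idx m) λ j → pos m j < pos m i × Contains (join (S i) u v) (S j)

Nice : {I : Set} → (I → Graph) → Set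
Nice {I} F = Σ (Maybe ℕ) λ m → Σ (Idx m ⤖ I) λ b → NiceSeq m (F ∘ Bijection.to b)

module Submission where

open import Defs
open import Data.Bool using (Bool; true; false; _∨_)
open import Data.Empty using (⊥-elim)
open import Data.Fin using (Fin; _≟_)
open import Data.Fin.Properties using (any?)
open import Data.Maybe using (Maybe)
open import Data.Nat using (ℕ; suc; _<_; s≤s)
open import Data.Nat.Properties using (<-≤-trans; n<1+n)
open import Data.Product using (Σ; _×_; _,_; proj₁; proj₂)
open import Data.Sum using (_⊎_; inj₁; inj₂)
open import Function using (_∘_)
open import Function.Bundles using (_⇔_; mk⇔; Equivalence; Bijection)
open import Function.Definitions using (Injective)
open import Relation.Nullary using (¬_; yes; no)
open import Relation.Binary.PropositionalEquality
  using (_≡_; _≢_; refl; sym; trans; subst; subst₂; ≢-sym)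

open Equivalence using (to; from)

-- Suppose a copy of some F_i, embedded by f, appears in G' = symmetrize G u v.
-- If u is not in the image of f, the copy already lies in G; if u = f a but v
-- is not in the image, moving a to v gives a copy in G.  Otherwise u = f a and
-- v = f b with a, b non-adjacent, and since u and v are twins in G', f also
-- embeds the join of F_i at a, b, which contains an earlier F_j.  Descending
-- along the nice order then contradicts well-foundedness of ℕ.

∨-true : ∀ a {b} → a ∨ b ≡ true → a ≡ true ⊎ b ≡ true
∨-true true  _ = inj₁ refl
∨-true false p = inj₂ p

∨-true⁻ : ∀ {a b} → a ≡ true ⊎ b ≡ true → a ∨ b ≡ true
∨-true⁻ {true}  _        = refl
∨-true⁻ {false} (inj₂ p) = p

edgeB⇒Edge : (G : Graph) {x y : V G} → edgeB G x y ≡ true → Edge G x y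
edgeB⇒Edge G {x} {y} p with x ≟ y
... | no x≢y = x≢y , ∨-true _ p

Edge⇒edgeB : (G : Graph) {x y : V G} → Edge G x y → edgeB G x y ≡ true
Edge⇒edgeB G {x} {y} (x≢y , e) with x ≟ y
... | yes x≡y = ⊥-elim (x≢y x≡y)
... | no _    = ∨-true⁻ e

Edge-sym : (G : Graph) {x y : V G} → Edge G x y → Edge G y x
Edge-sym G (x≢y , inj₁ e) = ≢-sym x≢y , inj₂ e
Edge-sym G (x≢y , inj₂ e) = ≢-sym x≢y , inj₁ e

Edge-irrefl : (G : Graph) {x : V G} → ¬ Edge G x x
Edge-irrefl G (x≢x , _) = x≢x refl

Edge-cong : ∀ {m} (A B : Fin m → Fin m → Bool) {x y : Fin m} →
  A x y ≡ B x y → A y x ≡ B y x → Edge (mkGraph m A) x y → Edge (mkGraph m B) x y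
Edge-cong _ _ p q (x≢y , inj₁ e) = x≢y , inj₁ (trans (sym p) e)
Edge-cong _ _ p q (x≢y , inj₂ e) = x≢y , inj₂ (trans (sym q) e)

Preserves : (F H : Graph) → (V F → V H) → Set
Preserves F H f = ∀ x y → Edge F x y → Edge H (f x) (f y)

Contains-trans : {G H K : Graph} → Contains G H → Contains H K → Contains G K
Contains-trans (f , f-inj , f-pres) (g , g-inj , g-pres) =
  f ∘ g , g-inj ∘ f-inj , λ x y → f-pres (g x) (g y) ∘ g-pres x y

Twins : (H : Graph) → V H → V H → Set
Twins H u v = ∀ w → w ≢ u → w ≢ v → Edge H u w ⇔ Edge H v w

edgeB-∨⇒Edge : (F : Graph) {a b y : V F} →
  edgeB F a y ∨ edgeB F b y ≡ true → Edge F a y ⊎ Edge F b y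
edgeB-∨⇒Edge F {a} p with ∨-true (edgeB F a _) p
... | inj₁ e = inj₁ (edgeB⇒Edge F e)
... | inj₂ e = inj₂ (edgeB⇒Edge F e)

join-adj : (F : Graph) (a b x y : V F) → adj (join F a b) x y ≡ true →
  adj F x y ≡ true ⊎ ((x ≡ a ⊎ x ≡ b) × (Edge F a y ⊎ Edge F b y))
join-adj F a b x y p with adj F x y
... | true  = inj₁ refl
... | false with x ≟ a | x ≟ b
...   | yes x≡a | _       = inj₂ (inj₁ x≡a , edgeB-∨⇒Edge F p)
...   | no _    | yes x≡b = inj₂ (inj₂ x≡b , edgeB-∨⇒Edge F p)

module _ {F H : Graph} {f : V F → V H} {a b : V F}
         (f-inj : Injective _≡_ _≡_ f) (a≁b : ¬ Edge F a b)
         (twins : Twins H (f a) (f b)) (pres : Preserves F H f) where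

  private
    apart : ∀ {y} → Edge F a y ⊎ Edge F b y → f y ≢ f a × f y ≢ f b
    apart (inj₁ e) = (λ p → Edge-irrefl F (subst (Edge F a) (f-inj p) e))
                   , (λ p → a≁b (subst (Edge F a) (f-inj p) e))
    apart (inj₂ e) = (λ p → a≁b (Edge-sym F (subst (Edge F b) (f-inj p) e)))
                   , (λ p → Edge-irrefl F (subst (Edge F b) (f-inj p) e))

    twin-at : ∀ {y} → Edge F a y ⊎ Edge F b y → Edge H (f a) (f y) ⇔ Edge H (f b) (f y)
    twin-at n = twins (f _) (proj₁ (apart n)) (proj₂ (apart n))

    join-Preserves-adj : ∀ {x y} → x ≢ y → adj (join F a b) x y ≡ true → Edge H (f x) (f y)
    join-Preserves-adj {x} {y} x≢y p with join-adj F a b x y p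
    ... | inj₁ q                   = pres x y (x≢y , inj₁ q)
    ... | inj₂ (inj₁ refl , inj₁ e) = pres a y e
    ... | inj₂ (inj₂ refl , inj₂ e) = pres b y e
    ... | inj₂ (inj₁ refl , inj₂ e) = from (twin-at (inj₂ e)) (pres b y e)
    ... | inj₂ (inj₂ refl , inj₁ e) = to (twin-at (inj₁ e)) (pres a y e)

  join-Preserves : Preserves (join F a b) H f
  join-Preserves x y (x≢y , inj₁ p) = join-Preserves-adj x≢y p
  join-Preserves x y (x≢y , inj₂ p) = Edge-sym H (join-Preserves-adj (≢-sym x≢y) p)

ContainsJoin : Graph → Graph → Set
ContainsJoin H F =
  Σ (V F) λ a → Σ (V F) λ b → a ≢ b × ¬ Edge F a b × Contains H (join F a b)

NiceSeq⇒Free : {m : Maybe ℕ} {S : Idx m → Graph} {H : Graph} → NiceSeq m S →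
  (∀ i → Contains H (S i) → ContainsJoin H (S i)) → ∀ i → ¬ Contains H (S i)
NiceSeq⇒Free {m} {S} {H} nice step i = descend (suc (pos m i)) i (n<1+n (pos m i))
  where
  descend : ∀ N i → pos m i < N → ¬ Contains H (S i)
  descend (suc N) i (s≤s i≤N) H⊇Si with step i H⊇Si
  ... | a , b , a≢b , a≁b , H⊇join with nice i a b a≢b a≁b
  ... | j , j<i , join⊇Sj =
    descend N j (<-≤-trans j<i i≤N) (Contains-trans {H} H⊇join join⊇Sj)

module _ (G : Graph) (u v : V G) where

  symmetrize-adj-away : ∀ {x y} → x ≢ u → y ≢ u → adj (symmetrize G u v) x y ≡ adj G x y
  symmetrize-adj-away {x} {y} x≢u y≢u with x ≟ u | y ≟ u
  ... | yes x≡u | _       = ⊥-elim (x≢u x≡u)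
  ... | no _    | yes y≡u = ⊥-elim (y≢u y≡u)
  ... | no _    | no _    = refl

  symmetrize-adj-from-u : ∀ y → adj (symmetrize G u v) u y ≡ edgeB G v y
  symmetrize-adj-from-u y with u ≟ u
  ... | yes _   = refl
  ... | no u≢u = ⊥-elim (u≢u refl)

  symmetrize-adj-to-u : ∀ {y} → y ≢ u → adj (symmetrize G u v) y u ≡ edgeB G v y
  symmetrize-adj-to-u {y} y≢u with y ≟ u | u ≟ u
  ... | yes y≡u | _      = ⊥-elim (y≢u y≡u)
  ... | no _    | yes _  = refl
  ... | no _    | no u≢u = ⊥-elim (u≢u refl)

  Edge-symmetrize-away : ∀ {x y} → x ≢ u → y ≢ u → Edge (symmetrize G u v) x y ⇔ Edge G x y
  Edge-symmetrize-away {x} {y} x≢u y≢u =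
    mk⇔ (Edge-cong (adj (symmetrize G u v)) (adj G) xy yx)
        (Edge-cong (adj G) (adj (symmetrize G u v)) (sym xy) (sym yx))
    where
    xy : adj (symmetrize G u v) x y ≡ adj G x y
    xy = symmetrize-adj-away x≢u y≢u
    yx : adj (symmetrize G u v) y x ≡ adj G y x
    yx = symmetrize-adj-away y≢u x≢u

  Edge-symmetrize-u : ∀ {w} → w ≢ u → Edge (symmetrize G u v) u w ⇔ Edge G v w
  Edge-symmetrize-u {w} w≢u = mk⇔ to-v from-v
    where
    to-v : Edge (symmetrize G u v) u w → Edge G v w
    to-v (_ , inj₁ e) = edgeB⇒Edge G (trans (sym (symmetrize-adj-from-u w)) e)
    to-v (_ , inj₂ e) = edgeB⇒Edge G (trans (sym (symmetrize-adj-to-u w≢u)) e)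
    from-v : Edge G v w → Edge (symmetrize G u v) u w
    from-v e = ≢-sym w≢u , inj₁ (trans (symmetrize-adj-from-u w) (Edge⇒edgeB G e))

  module _ {F : Graph} {f : V F → V G} (f-inj : Injective _≡_ _≡_ f)
           (pres : Preserves F (symmetrize G u v) f) where

    symmetrize-Preserves-avoiding : (∀ x → f x ≢ u) → Preserves F G f
    symmetrize-Preserves-avoiding u∉f x y =
      to (Edge-symmetrize-away (u∉f x) (u∉f y)) ∘ pres x y

    symmetrize-Contains-redirect : ∀ {a} → f a ≡ u → (∀ x → f x ≢ v) → Contains G F
    symmetrize-Contains-redirect {a} fa≡u v∉f = g , g-inj , g-pres
      where
      g : V F → V G
      g x with x ≟ a
      ... | yes _ = v
      ... | no _  = f x

      off-u : ∀ {x} → x ≢ a → f x ≢ u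
      off-u x≢a fx≡u = x≢a (f-inj (trans fx≡u (sym fa≡u)))

      from-a : ∀ {y} → y ≢ a → Edge F a y → Edge G v (f y)
      from-a y≢a e =
        to (Edge-symmetrize-u (off-u y≢a))
           (subst (λ z → Edge (symmetrize G u v) z (f _)) fa≡u (pres _ _ e))

      g-inj : Injective _≡_ _≡_ g
      g-inj {x} {y} p with x ≟ a | y ≟ a
      ... | yes x≡a | yes y≡a = trans x≡a (sym y≡a)
      ... | yes _   | no _    = ⊥-elim (v∉f y (sym p))
      ... | no _    | yes _   = ⊥-elim (v∉f x p)
      ... | no _    | no _    = f-inj p

      g-pres : Preserves F G g
      g-pres x y e with x ≟ a | y ≟ a
      ... | yes refl | yes refl = ⊥-elim (Edge-irrefl F e)
      ... | yes refl | no y≢a   = from-a y≢a e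
      ... | no x≢a   | yes refl = Edge-sym G (from-a x≢a (Edge-sym F e))
      ... | no x≢a   | no y≢a   =
        to (Edge-symmetrize-away (off-u x≢a) (off-u y≢a)) (pres x y e)

  module _ (u≢v : u ≢ v) where

    symmetrize-Twins : Twins (symmetrize G u v) u v
    symmetrize-Twins w w≢u w≢v =
      mk⇔ (from (Edge-symmetrize-away (≢-sym u≢v) w≢u) ∘ to (Edge-symmetrize-u w≢u))
          (from (Edge-symmetrize-u w≢u) ∘ to (Edge-symmetrize-away (≢-sym u≢v) w≢u))

    symmetrize-u≁v : ¬ Edge (symmetrize G u v) u v
    symmetrize-u≁v = Edge-irrefl G ∘ to (Edge-symmetrize-u (≢-sym u≢v))

    symmetrize-ContainsJoin : {F : Graph} → ¬ Contains G F →
      Contains (symmetrize G u v) F → ContainsJoin (symmetrize G u v) F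
    symmetrize-ContainsJoin {F} G⊉F (f , f-inj , pres) with any? (λ x → f x ≟ u)
    ... | no u∉f = ⊥-elim (G⊉F (f , f-inj , symmetrize-Preserves-avoiding f-inj pres
                                          (λ x fx≡u → u∉f (x , fx≡u))))
    ... | yes (a , fa≡u) with any? (λ x → f x ≟ v)
    ... | no v∉f = ⊥-elim (G⊉F (symmetrize-Contains-redirect f-inj pres fa≡u
                                  (λ x fx≡v → v∉f (x , fx≡v))))
    ... | yes (b , fb≡v) = a , b , a≢b , a≁b , f , f-inj ,
                           join-Preserves {H = symmetrize G u v} f-inj a≁b fa-fb-twins pres
      where
      a≢b : a ≢ b
      a≢b refl = u≢v (trans (sym fa≡u) fb≡v)
      a≁b : ¬ Edge F a b
      a≁b e = symmetrize-u≁v (subst₂ (Edge (symmetrize G u v)) fa≡u fb≡v (pres a b e))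
      fa-fb-twins : Twins (symmetrize G u v) (f a) (f b)
      fa-fb-twins = subst₂ (Twins (symmetrize G u v)) (sym fa≡u) (sym fb≡v) symmetrize-Twins

proposition9 : {I : Set} (F : I → Graph) → Nice F →
    (G : Graph) → Free F G → (u v : V G) → u ≢ v → ¬ Edge G u v →
    Free F (symmetrize G u v)
proposition9 F (m , order , nice) G G-free u v u≢v _ ι
  with Bijection.strictlySurjective order ι
... | i , refl =
  NiceSeq⇒Free {H = symmetrize G u v} nice
    (λ j → symmetrize-ContainsJoin G u v u≢v (G-free (Bijection.to order j))) i
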